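{- Let $(T_1,T_2)$ be an ordered pair of disjoint triangulations of a convex $n$-gon. If $(T_1',T_2')$ is obtained from $(T_1,T_2)$ by a flip at $(a,b)_i$ for some diagonal $(a,b)\in T_i$, $i\in\{1,2\}$, then $(T_1',T_2')$ is also an ordered pair of disjoint triangulations, and $(T_1,T_2)$ can be obtained from $(T_1',T_2')$ by some flip.
   Context: Label the vertices of a convex $n$-gon by $1,\dots,n$. A triangulation is a maximal set of pairwise noncrossing diagonals; two triangulations are disjoint if they share no diagonal. If $(a,b)$ is a diagonal of a triangulation $T$, deleting it leaves a unique quadrilateral $(a,a',b,b')$; the flip of $T$ at $(a,b)$ replaces $(a,b)$ by $(a',b')$. For an ordered pair $(T_1,T_2)$ of disjoint triangulations and a diagonal $(a,b)\in T_i$, the flip at $(a,b)_i$ is: (a) flip $(a,b)$ in $T_i$, obtaining a new diagonal $(a',b')$; (b) if $(a',b')\in T_j$ with $j\ne i$, then also flip $(a',b')$ in $T_j$. -}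

module Defs where

open import Data.Nat using (ℕ; suc; _+_; _<_; _≤_; _⊓_; _⊔_)
open import Data.Product using (Σ; _×_)
open import Data.Sum using (_⊎_)
open import Data.Empty using (⊥)
open import Relation.Nullary using (¬_)
open import Relation.Binary.PropositionalEquality using (_≡_)

-- Vertices of the convex n-gon are 1,…,n (in cyclic order).
-- A diagonal is recorded as an ordered pair (a , b) with a < b.
-- A set of diagonals is a predicate on such pairs.
DSet : Set₁
DSet = ℕ → ℕ → Set

IsDiag : ℕ → ℕ → ℕ → Set
IsDiag n a b = (1 ≤ a) × (a + 2 ≤ b) × (b ≤ n) × ¬ ((a ≡ 1) × (b ≡ n))

Cross : ℕ → ℕ → ℕ → ℕ → Set
Cross a b c d = ((a < c) × (c < b) × (b < d)) ⊎ ((c < a) × (a < d) × (d < b))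

IsTriangulation : ℕ → DSet → Set
IsTriangulation n T =
  (∀ a b → T a b → IsDiag n a b)
  × (∀ a b c d → T a b → T c d → ¬ Cross a b c d)
  × (∀ c d → IsDiag n c d → (∀ a b → T a b → ¬ Cross a b c d) → T c d)

Disjoint : DSet → DSet → Set
Disjoint T₁ T₂ = ∀ a b → T₁ a b → T₂ a b → ⊥

_≐_ : DSet → DSet → Set
S ≐ S' = ∀ x y → (S x y → S' x y) × (S' x y → S x y)

Edge : ℕ → DSet → ℕ → ℕ → Set
Edge n T x y = T x y ⊎ ((1 ≤ x) × (y ≡ suc x) × (y ≤ n)) ⊎ ((x ≡ 1) × (y ≡ n))

-- Deleting the diagonal (a,b) (a < b) of T leaves the quadrilateral
-- (a, a', b, b') in cyclic order: a < a' < b and b' on the other side,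
-- with triangles a a' b and a b b' both faces of T.
Quad : ℕ → DSet → ℕ → ℕ → ℕ → ℕ → Set
Quad n T a b a' b' =
  (a < a') × (a' < b) × (((b < b') × (b' ≤ n)) ⊎ ((1 ≤ b') × (b' < a)))
  × Edge n T a a' × Edge n T a' b
  × Edge n T (b ⊓ b') (b ⊔ b') × Edge n T (a ⊓ b') (a ⊔ b')

FlipWith : ℕ → DSet → ℕ → ℕ → ℕ → ℕ → DSet → Set
FlipWith n T a b a' b' T' =
  Quad n T a b a' b'
  × (T' ≐ (λ x y → (T x y × ¬ ((x ≡ a) × (y ≡ b)))
                   ⊎ ((x ≡ a' ⊓ b') × (y ≡ a' ⊔ b'))))

FlipsTo : ℕ → DSet → ℕ → ℕ → DSet → Set
FlipsTo n T a b T' = Σ ℕ λ a' → Σ ℕ λ b' → FlipWith n T a b a' b' T'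

-- Flip at (a,b)_i, with Tᵢ the triangulation containing (a,b) and Tⱼ the other:
-- (a) flip (a,b) in Tᵢ giving (a',b'); (b) if (a',b') ∈ Tⱼ also flip it in Tⱼ,
-- otherwise Tⱼ is unchanged.
FlipAtSide : ℕ → DSet → DSet → DSet → DSet → Set
FlipAtSide n Ti Tj Ti' Tj' =
  Σ ℕ λ a → Σ ℕ λ b → Ti a b × (Σ ℕ λ a' → Σ ℕ λ b' →
    FlipWith n Ti a b a' b' Ti'
    × ((Tj (a' ⊓ b') (a' ⊔ b') × FlipsTo n Tj (a' ⊓ b') (a' ⊔ b') Tj')
       ⊎ (¬ Tj (a' ⊓ b') (a' ⊔ b') × (Tj' ≐ Tj))))

PairFlip : ℕ → DSet → DSet → DSet → DSet → Set
PairFlip n T₁ T₂ T₁' T₂' = FlipAtSide n T₁ T₂ T₁' T₂' ⊎ FlipAtSide n T₂ T₁ T₂' T₁'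

{-# OPTIONS --safe #-}
-- Deleting (a,b) from T leaves the quadrilateral a a' b b'. A diagonal of T other than (a,b)
-- that crossed (a',b') would have to separate two adjacent corners of this quadrilateral, i.e.
-- cross one of its sides, so T' is noncrossing. A diagonal crossing (a,b) but no edge of T'
-- cannot separate adjacent corners, so its endpoints are a' and b', which gives maximality.
-- Flipping (a',b') in T' sees the same quadrilateral and restores (a,b). For the pair, the new
-- diagonal of Tᵢ' and the new one of Tⱼ' cross, so T₁' and T₂' stay disjoint, and the flip is
-- undone at (a',b')ᵢ, or, when Tⱼ was flipped too, at the new diagonal of Tⱼ'.
module Submission where

open import Defs
open import Data.Nat using (ℕ; suc; _+_; _<_; _≤_; _⊓_; _⊔_; _≟_; _<?_; s≤s; z≤n)
open import Data.Nat.Properties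
open import Data.Product using (Σ; _×_; _,_; proj₁; proj₂)
open import Data.Sum using (_⊎_; inj₁; inj₂)
open import Data.Empty using (⊥-elim)
open import Function using (case_of_)
open import Relation.Nullary using (¬_; Dec; yes; no)
open import Relation.Nullary.Decidable using (_×-dec_; _⊎-dec_)
open import Relation.Binary using (tri<; tri≈; tri>)
open import Relation.Binary.PropositionalEquality using (_≡_; _≢_; refl; sym; trans; subst₂)

Inside Outside Endpoint : ℕ → ℕ → ℕ → Set
Inside   x y z = x < z × z < y
Outside  x y z = z < x ⊎ y < z
Endpoint x y z = z ≡ x ⊎ z ≡ y

Separates : ℕ → ℕ → ℕ → ℕ → Set
Separates x y u v = (Inside x y u × Outside x y v) ⊎ (Outside x y u × Inside x y v)

data Position (x y z : ℕ) : Set where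
  inside   : Inside x y z → Position x y z
  outside  : Outside x y z → Position x y z
  endpoint : Endpoint x y z → Position x y z

position : ∀ x y z → Position x y z
position x y z with <-cmp x z | <-cmp z y
... | tri< x<z _ _ | tri< z<y _ _ = inside (x<z , z<y)
... | tri< _ _ _   | tri≈ _ z≡y _ = endpoint (inj₂ z≡y)
... | tri< _ _ _   | tri> _ _ y<z = outside (inj₂ y<z)
... | tri≈ _ x≡z _ | _            = endpoint (inj₁ (sym x≡z))
... | tri> _ _ z<x | _            = outside (inj₁ z<x)

Separates-sym : ∀ {x y u v} → Separates x y u v → Separates x y v u
Separates-sym (inj₁ (i , o)) = inj₂ (o , i)
Separates-sym (inj₂ (o , i)) = inj₁ (i , o)

Separates-⊓⊔ : ∀ {x y} u v → Separates x y u v → Separates x y (u ⊓ v) (u ⊔ v)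
Separates-⊓⊔ u v s with ≤-total u v
... | inj₁ u≤v rewrite m≤n⇒m⊓n≡m u≤v | m≤n⇒m⊔n≡n u≤v = s
... | inj₂ v≤u rewrite m≥n⇒m⊓n≡n v≤u | m≥n⇒m⊔n≡m v≤u = Separates-sym s

Separates-⊓⊔⁻ : ∀ {x y} u v → Separates x y (u ⊓ v) (u ⊔ v) → Separates x y u v
Separates-⊓⊔⁻ u v s with ≤-total u v
... | inj₁ u≤v rewrite m≤n⇒m⊓n≡m u≤v | m≤n⇒m⊔n≡n u≤v = s
... | inj₂ v≤u rewrite m≥n⇒m⊓n≡n v≤u | m≥n⇒m⊔n≡m v≤u = Separates-sym s

Cross⇒Separates : ∀ {x y u v} → Cross x y u v → Separates x y u v
Cross⇒Separates (inj₁ (x<u , u<y , y<v)) = inj₁ ((x<u , u<y) , inj₂ y<v)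
Cross⇒Separates (inj₂ (u<x , x<v , v<y)) = inj₂ (inj₁ u<x , (x<v , v<y))

Separates⇒Cross : ∀ {x y u v} → u < v → Separates x y u v → Cross x y u v
Separates⇒Cross u<v (inj₁ ((x<u , u<y) , inj₁ v<x)) = ⊥-elim (<-asym (<-trans x<u u<v) v<x)
Separates⇒Cross u<v (inj₁ ((x<u , u<y) , inj₂ y<v)) = inj₁ (x<u , u<y , y<v)
Separates⇒Cross u<v (inj₂ (inj₁ u<x , (x<v , v<y))) = inj₂ (u<x , x<v , v<y)
Separates⇒Cross u<v (inj₂ (inj₂ y<u , (x<v , v<y))) = ⊥-elim (<-asym (<-trans v<y y<u) u<v)

Cross-sym : ∀ {x y u v} → Cross x y u v → Cross u v x y
Cross-sym (inj₁ c) = inj₂ c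
Cross-sym (inj₂ c) = inj₁ c

Cross-irrefl : ∀ {x y} → ¬ Cross x y x y
Cross-irrefl (inj₁ (x<x , _)) = <-irrefl refl x<x
Cross-irrefl (inj₂ (x<x , _)) = <-irrefl refl x<x

cross? : ∀ x y u v → Dec (Cross x y u v)
cross? x y u v =
  ((x <? u) ×-dec ((u <? y) ×-dec (y <? v))) ⊎-dec ((u <? x) ×-dec ((x <? v) ×-dec (v <? y)))

data SeparatesSideOf (x y z₁ z₂ z₃ z₄ : ℕ) : Set where
  side₁₂ : Separates x y z₁ z₂ → SeparatesSideOf x y z₁ z₂ z₃ z₄
  side₂₃ : Separates x y z₂ z₃ → SeparatesSideOf x y z₁ z₂ z₃ z₄
  side₃₄ : Separates x y z₃ z₄ → SeparatesSideOf x y z₁ z₂ z₃ z₄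
  side₄₁ : Separates x y z₄ z₁ → SeparatesSideOf x y z₁ z₂ z₃ z₄
  diagonal₁₃ : Endpoint x y z₁ → Endpoint x y z₃ → SeparatesSideOf x y z₁ z₂ z₃ z₄

separatesSide : ∀ {x y} z₁ z₂ z₃ z₄ → Separates x y z₂ z₄ → SeparatesSideOf x y z₁ z₂ z₃ z₄
separatesSide {x} {y} z₁ z₂ z₃ z₄ (inj₁ (i₂ , o₄)) with position x y z₁ | position x y z₃
... | inside i₁   | _            = side₄₁ (inj₂ (o₄ , i₁))
... | outside o₁  | _            = side₁₂ (inj₂ (o₁ , i₂))
... | endpoint _  | inside i₃    = side₃₄ (inj₁ (i₃ , o₄))
... | endpoint _  | outside o₃   = side₂₃ (inj₁ (i₂ , o₃))
... | endpoint e₁ | endpoint e₃  = diagonal₁₃ e₁ e₃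
separatesSide {x} {y} z₁ z₂ z₃ z₄ (inj₂ (o₂ , i₄)) with position x y z₁ | position x y z₃
... | inside i₁   | _            = side₁₂ (inj₁ (i₁ , o₂))
... | outside o₁  | _            = side₄₁ (inj₁ (i₄ , o₁))
... | endpoint _  | inside i₃    = side₂₃ (inj₂ (o₂ , i₃))
... | endpoint _  | outside o₃   = side₃₄ (inj₂ (o₃ , i₄))
... | endpoint e₁ | endpoint e₃  = diagonal₁₃ e₁ e₃

unseparated-middle⇒Endpoint : ∀ {x y} z₁ z₂ z₃ → Separates x y z₁ z₃
  → ¬ Separates x y z₁ z₂ → ¬ Separates x y z₂ z₃ → Endpoint x y z₂
unseparated-middle⇒Endpoint {x} {y} z₁ z₂ z₃ s ¬s₁₂ ¬s₂₃ with position x y z₂ | s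
... | inside i₂   | inj₁ (_ , o₃)  = ⊥-elim (¬s₂₃ (inj₁ (i₂ , o₃)))
... | inside i₂   | inj₂ (o₁ , _)  = ⊥-elim (¬s₁₂ (inj₂ (o₁ , i₂)))
... | outside o₂  | inj₁ (i₁ , _)  = ⊥-elim (¬s₁₂ (inj₁ (i₁ , o₂)))
... | outside o₂  | inj₂ (_ , i₃)  = ⊥-elim (¬s₂₃ (inj₂ (o₂ , i₃)))
... | endpoint e  | _              = e

Endpoints⇒≡ : ∀ {x y u v} → x < y → u < v → Endpoint x y u → Endpoint x y v → x ≡ u × y ≡ v
Endpoints⇒≡ _   u<v (inj₁ refl) (inj₁ refl) = ⊥-elim (<-irrefl refl u<v)
Endpoints⇒≡ _   _   (inj₁ refl) (inj₂ refl) = refl , refl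
Endpoints⇒≡ x<y u<v (inj₂ refl) (inj₁ refl) = ⊥-elim (<-asym x<y u<v)
Endpoints⇒≡ _   u<v (inj₂ refl) (inj₂ refl) = ⊥-elim (<-irrefl refl u<v)

Endpoints⇒≡⊓⊔ : ∀ {x y u v} → x < y → Endpoint x y u → Endpoint x y v → u ≢ v
  → x ≡ u ⊓ v × y ≡ u ⊔ v
Endpoints⇒≡⊓⊔ _   (inj₁ refl) (inj₁ refl) u≢v = ⊥-elim (u≢v refl)
Endpoints⇒≡⊓⊔ x<y (inj₁ refl) (inj₂ refl) _ =
  sym (m≤n⇒m⊓n≡m (<⇒≤ x<y)) , sym (m≤n⇒m⊔n≡n (<⇒≤ x<y))
Endpoints⇒≡⊓⊔ x<y (inj₂ refl) (inj₁ refl) _ =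
  sym (m≥n⇒m⊓n≡n (<⇒≤ x<y)) , sym (m≥n⇒m⊔n≡m (<⇒≤ x<y))
Endpoints⇒≡⊓⊔ _   (inj₂ refl) (inj₂ refl) u≢v = ⊥-elim (u≢v refl)

Side : ℕ → ℕ → ℕ → Set
Side n u v = ((1 ≤ u) × (v ≡ suc u) × (v ≤ n)) ⊎ ((u ≡ 1) × (v ≡ n))

Side⇒¬Separates : ∀ {n x y u v} → 1 ≤ x → y ≤ n → Side n u v → ¬ Separates x y u v
Side⇒¬Separates _ _ (inj₁ (_ , refl , _)) (inj₁ ((x<u , _) , inj₁ 1+u<x)) =
  <-asym x<u (<-trans (n<1+n _) 1+u<x)
Side⇒¬Separates _ _ (inj₁ (_ , refl , _)) (inj₁ ((_ , u<y) , inj₂ y<1+u)) =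
  <-irrefl refl (<-≤-trans u<y (≤-pred y<1+u))
Side⇒¬Separates _ _ (inj₁ (_ , refl , _)) (inj₂ (inj₁ u<x , (x<1+u , _))) =
  <-irrefl refl (<-≤-trans u<x (≤-pred x<1+u))
Side⇒¬Separates _ _ (inj₁ (_ , refl , _)) (inj₂ (inj₂ y<u , (_ , 1+u<y))) =
  <-asym y<u (<-trans (n<1+n _) 1+u<y)
Side⇒¬Separates 1≤x _ (inj₂ (refl , refl)) (inj₁ ((x<1 , _) , _)) = <-irrefl refl (<-≤-trans x<1 1≤x)
Side⇒¬Separates _ y≤n (inj₂ (refl , refl)) (inj₂ (_ , (_ , n<y))) = <-irrefl refl (<-≤-trans n<y y≤n)

Edge⇒¬Separates : ∀ {n S x y u v} → 1 ≤ x → y ≤ n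
  → (∀ u v → S u v → ¬ Separates x y u v) → Edge n S u v → ¬ Separates x y u v
Edge⇒¬Separates _ _ ¬sep (inj₁ s) = ¬sep _ _ s
Edge⇒¬Separates 1≤x y≤n _ (inj₂ side) = Side⇒¬Separates 1≤x y≤n side

IsDiag⇒< : ∀ {n u v} → IsDiag n u v → u < v
IsDiag⇒< {u = u} (_ , u+2≤v , _) = <-≤-trans (m<m+n u (s≤s z≤n)) u+2≤v

≐-sym : ∀ {S S'} → S ≐ S' → S' ≐ S
≐-sym S≐S' x y = proj₂ (S≐S' x y) , proj₁ (S≐S' x y)

Disjoint-sym : ∀ {S S'} → Disjoint S S' → Disjoint S' S
Disjoint-sym disjoint x y s' s = disjoint x y s s'

IsTriangulation-resp-≐ : ∀ {n S S'} → S ≐ S' → IsTriangulation n S' → IsTriangulation n S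
IsTriangulation-resp-≐ S≐S' (diag , noncrossing , maximal) =
  (λ a b s → diag a b (to S≐S' s)) ,
  (λ a b c d s t → noncrossing a b c d (to S≐S' s) (to S≐S' t)) ,
  (λ c d cd ¬cross → proj₂ (S≐S' c d) (maximal c d cd (λ a b s' → ¬cross a b (proj₂ (S≐S' a b) s'))))
  where
    to : ∀ {S S'} → S ≐ S' → ∀ {x y} → S x y → S' x y
    to S≐S' {x} {y} = proj₁ (S≐S' x y)

module Flip {n : ℕ} {T T' : DSet} (tri : IsTriangulation n T) {a b a' b' : ℕ} (ab∈T : T a b)
  (a<a' : a < a') (a'<b : a' < b) (b'-pos : ((b < b') × (b' ≤ n)) ⊎ ((1 ≤ b') × (b' < a)))
  (aa' : Edge n T a a') (a'b : Edge n T a' b)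
  (bb' : Edge n T (b ⊓ b') (b ⊔ b')) (ab' : Edge n T (a ⊓ b') (a ⊔ b'))
  (T'≐ : T' ≐ (λ x y → (T x y × ¬ ((x ≡ a) × (y ≡ b))) ⊎ ((x ≡ a' ⊓ b') × (y ≡ a' ⊔ b'))))
  where

  p q : ℕ
  p = a' ⊓ b'
  q = a' ⊔ b'

  T'-cases : ∀ {x y} → T' x y → (T x y × ¬ ((x ≡ a) × (y ≡ b))) ⊎ ((x ≡ p) × (y ≡ q))
  T'-cases {x} {y} = proj₁ (T'≐ x y)

  kept : ∀ {x y} → T x y → ¬ ((x ≡ a) × (y ≡ b)) → T' x y
  kept {x} {y} t ≢ab = proj₂ (T'≐ x y) (inj₁ (t , ≢ab))

  pq∈T' : T' p q
  pq∈T' = proj₂ (T'≐ p q) (inj₂ (refl , refl))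

  diagT : ∀ {x y} → T x y → IsDiag n x y
  diagT {x} {y} = proj₁ tri x y

  noncrossingT : ∀ {x y u v} → T x y → T u v → ¬ Cross x y u v
  noncrossingT {x} {y} {u} {v} = proj₁ (proj₂ tri) x y u v

  a<b : a < b
  a<b = <-trans a<a' a'<b

  1≤a : 1 ≤ a
  1≤a = proj₁ (diagT ab∈T)

  b≤n : b ≤ n
  b≤n = proj₁ (proj₂ (proj₂ (diagT ab∈T)))

  pq-cases : ((p ≡ a') × (q ≡ b') × (b < b') × (b' ≤ n))
           ⊎ ((p ≡ b') × (q ≡ a') × (1 ≤ b') × (b' < a))
  pq-cases = case b'-pos of λ
    { (inj₁ (b<b' , b'≤n)) → let a'≤b' = <⇒≤ (<-trans a'<b b<b') in
        inj₁ (m≤n⇒m⊓n≡m a'≤b' , m≤n⇒m⊔n≡n a'≤b' , b<b' , b'≤n)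
    ; (inj₂ (1≤b' , b'<a)) → let b'≤a' = <⇒≤ (<-trans b'<a a<a') in
        inj₂ (m≥n⇒m⊓n≡n b'≤a' , m≥n⇒m⊔n≡m b'≤a' , 1≤b' , b'<a)
    }

  b'-outside : Outside a b b'
  b'-outside = case b'-pos of λ { (inj₁ (b<b' , _)) → inj₂ b<b' ; (inj₂ (_ , b'<a)) → inj₁ b'<a }

  a'≢b' : a' ≢ b'
  a'≢b' a'≡b' = case b'-outside of λ
    { (inj₁ b'<a) → <-irrefl (sym a'≡b') (<-trans b'<a a<a') ; (inj₂ b<b') → <-irrefl a'≡b' (<-trans a'<b b<b') }

  a≢b' : a ≢ b'
  a≢b' a≡b' = case b'-outside of λ
    { (inj₁ b'<a) → <-irrefl (sym a≡b') b'<a ; (inj₂ b<b') → <-irrefl a≡b' (<-trans a<b b<b') }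

  b≢b' : b ≢ b'
  b≢b' b≡b' = case b'-outside of λ
    { (inj₁ b'<a) → <-irrefl (sym b≡b') (<-trans b'<a a<b) ; (inj₂ b<b') → <-irrefl b≡b' b<b' }

  diagPQ : IsDiag n p q
  diagPQ with pq-cases
  ... | inj₁ (p≡a' , q≡b' , b<b' , b'≤n) = diag p≡a' q≡b'
    where
      diag : ∀ {P Q} → P ≡ a' → Q ≡ b' → IsDiag n P Q
      diag refl refl =
        ≤-trans 1≤a (<⇒≤ a<a') , ≤-trans (≤-reflexive (+-comm a' 2)) (≤-trans (s≤s a'<b) b<b') , b'≤n ,
        λ { (a'≡1 , _) → <-irrefl refl (<-≤-trans (subst₂ _<_ refl a'≡1 a<a') 1≤a) }
  ... | inj₂ (p≡b' , q≡a' , 1≤b' , b'<a) = diag p≡b' q≡a'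
    where
      diag : ∀ {P Q} → P ≡ b' → Q ≡ a' → IsDiag n P Q
      diag refl refl =
        1≤b' , ≤-trans (≤-reflexive (+-comm b' 2)) (≤-trans (s≤s b'<a) a<a') , <⇒≤ (<-≤-trans a'<b b≤n) ,
        λ { (_ , a'≡n) → <-irrefl a'≡n (<-≤-trans a'<b b≤n) }

  ab-crosses-pq : Cross a b p q
  ab-crosses-pq = Separates⇒Cross (IsDiag⇒< diagPQ) (Separates-⊓⊔ a' b' separates-a'b')
    where
      separates-a'b' : Separates a b a' b'
      separates-a'b' = inj₁ ((a<a' , a'<b) , b'-outside)

  pq∉T : ¬ T p q
  pq∉T pq∈T = noncrossingT ab∈T pq∈T ab-crosses-pq

  edge-unseparated : ∀ {x y u v} → T x y → Edge n T u v → ¬ Separates x y u v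
  edge-unseparated xy∈T = Edge⇒¬Separates (proj₁ (diagT xy∈T)) (proj₁ (proj₂ (proj₂ (diagT xy∈T))))
    (λ u v uv∈T s → noncrossingT xy∈T uv∈T (Separates⇒Cross (IsDiag⇒< (diagT uv∈T)) s))

  ¬Cross-pq : ∀ {x y} → T x y → ¬ ((x ≡ a) × (y ≡ b)) → ¬ Cross x y p q
  ¬Cross-pq xy∈T ≢ab c
    with separatesSide a a' b b' (Separates-⊓⊔⁻ a' b' (Cross⇒Separates c))
  ... | side₁₂ s = edge-unseparated xy∈T aa' s
  ... | side₂₃ s = edge-unseparated xy∈T a'b s
  ... | side₃₄ s = edge-unseparated xy∈T bb' (Separates-⊓⊔ b b' s)
  ... | side₄₁ s = edge-unseparated xy∈T ab' (Separates-⊓⊔ a b' (Separates-sym s))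
  ... | diagonal₁₃ e₁ e₃ = ≢ab (Endpoints⇒≡ (IsDiag⇒< (diagT xy∈T)) a<b e₁ e₃)

  diagT' : ∀ x y → T' x y → IsDiag n x y
  diagT' x y t with T'-cases t
  ... | inj₁ (xy∈T , _)  = diagT xy∈T
  ... | inj₂ (refl , refl) = diagPQ

  noncrossingT' : ∀ x y u v → T' x y → T' u v → ¬ Cross x y u v
  noncrossingT' x y u v s t with T'-cases s | T'-cases t
  ... | inj₁ (xy∈T , _)     | inj₁ (uv∈T , _)     = noncrossingT xy∈T uv∈T
  ... | inj₁ (xy∈T , ≢ab)   | inj₂ (refl , refl)  = ¬Cross-pq xy∈T ≢ab
  ... | inj₂ (refl , refl)  | inj₁ (uv∈T , ≢ab)   = λ c → ¬Cross-pq uv∈T ≢ab (Cross-sym c)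
  ... | inj₂ (refl , refl)  | inj₂ (refl , refl)  = Cross-irrefl

  keptEdge : ∀ {u v} → Edge n T u v → ¬ ((u ≡ a) × (v ≡ b)) → Edge n T' u v
  keptEdge (inj₁ uv∈T) ≢ab = inj₁ (kept uv∈T ≢ab)
  keptEdge (inj₂ side) _   = inj₂ side

  aa'≢ab : ¬ ((a ≡ a) × (a' ≡ b))
  aa'≢ab (_ , a'≡b) = <-irrefl a'≡b a'<b

  a'b≢ab : ¬ ((a' ≡ a) × (b ≡ b))
  a'b≢ab (a'≡a , _) = <-irrefl (sym a'≡a) a<a'

  bb'≢ab : ¬ ((b ⊓ b' ≡ a) × (b ⊔ b' ≡ b))
  bb'≢ab (min≡a , _) with ⊓-sel b b'
  ... | inj₁ min≡b  = <-irrefl (trans (sym min≡a) min≡b) a<b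
  ... | inj₂ min≡b' = a≢b' (trans (sym min≡a) min≡b')

  ab'≢ab : ¬ ((a ⊓ b' ≡ a) × (a ⊔ b' ≡ b))
  ab'≢ab (_ , max≡b) with ⊔-sel a b'
  ... | inj₁ max≡a  = <-irrefl (trans (sym max≡a) max≡b) a<b
  ... | inj₂ max≡b' = b≢b' (trans (sym max≡b) max≡b')

  maximalT' : ∀ c d → IsDiag n c d → (∀ x y → T' x y → ¬ Cross x y c d) → T' c d
  maximalT' c d cd ¬cross with cross? a b c d
  ... | no ¬ab-cd with (c ≟ a) ×-dec (d ≟ b)
  ...   | yes (refl , refl) = ⊥-elim (¬cross p q pq∈T' (Cross-sym ab-crosses-pq))
  ...   | no ≢ab = kept cd∈T ≢ab
    where
      ¬crossT : ∀ x y → T x y → ¬ Cross x y c d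
      ¬crossT x y xy∈T with (x ≟ a) ×-dec (y ≟ b)
      ... | yes (refl , refl) = ¬ab-cd
      ... | no ≢ab' = ¬cross x y (kept xy∈T ≢ab')
      cd∈T : T c d
      cd∈T = proj₂ (proj₂ tri) c d cd ¬crossT
  maximalT' c d cd ¬cross | yes ab-cd =
    proj₂ (T'≐ c d) (inj₂ (Endpoints⇒≡⊓⊔ (IsDiag⇒< cd) a'-endpoint b'-endpoint a'≢b'))
    where
      unseparated : ∀ {u v} → Edge n T' u v → ¬ Separates c d u v
      unseparated = Edge⇒¬Separates (proj₁ cd) (proj₁ (proj₂ (proj₂ cd)))
        (λ u v uv∈T' s → ¬cross u v uv∈T' (Cross-sym (Separates⇒Cross (IsDiag⇒< (diagT' u v uv∈T')) s)))
      separates-ab : Separates c d a b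
      separates-ab = Cross⇒Separates (Cross-sym ab-cd)
      a'-endpoint : Endpoint c d a'
      a'-endpoint = unseparated-middle⇒Endpoint a a' b separates-ab
        (unseparated (keptEdge aa' aa'≢ab)) (unseparated (keptEdge a'b a'b≢ab))
      b'-endpoint : Endpoint c d b'
      b'-endpoint = unseparated-middle⇒Endpoint b b' a (Separates-sym separates-ab)
        (λ s → unseparated (keptEdge bb' bb'≢ab) (Separates-⊓⊔ b b' s))
        (λ s → unseparated (keptEdge ab' ab'≢ab) (Separates-⊓⊔ a b' (Separates-sym s)))

  isTriangulation : IsTriangulation n T'
  isTriangulation = diagT' , noncrossingT' , maximalT'

  unflip-≐ : ∀ {a'' b''} → a'' ⊓ b'' ≡ a → a'' ⊔ b'' ≡ b
    → T ≐ (λ x y → (T' x y × ¬ ((x ≡ p) × (y ≡ q))) ⊎ ((x ≡ a'' ⊓ b'') × (y ≡ a'' ⊔ b'')))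
  unflip-≐ refl refl x y = to , from
    where
      to : T x y → (T' x y × ¬ ((x ≡ p) × (y ≡ q))) ⊎ ((x ≡ a) × (y ≡ b))
      to xy∈T with (x ≟ a) ×-dec (y ≟ b)
      ... | yes ≡ab = inj₂ ≡ab
      ... | no ≢ab  = inj₁ (kept xy∈T ≢ab , λ { (refl , refl) → pq∉T xy∈T })
      from : (T' x y × ¬ ((x ≡ p) × (y ≡ q))) ⊎ ((x ≡ a) × (y ≡ b)) → T x y
      from (inj₁ (xy∈T' , ≢pq)) with T'-cases xy∈T'
      ... | inj₁ (xy∈T , _) = xy∈T
      ... | inj₂ ≡pq        = ⊥-elim (≢pq ≡pq)
      from (inj₂ (refl , refl)) = ab∈T

  -- The quadrilateral around (p,q) in T' is a' b a b' in the first case and b' a a' b in the second.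
  unflip : Σ ℕ λ a'' → Σ ℕ λ b'' → FlipWith n T' p q a'' b'' T × (a'' ⊓ b'' ≡ a) × (a'' ⊔ b'' ≡ b)
  unflip with pq-cases
  ... | inj₁ (p≡a' , q≡b' , b<b' , _) =
    b , a , (quad p≡a' q≡b' , unflip-≐ ba-min ba-max) , ba-min , ba-max
    where
      ba-min : b ⊓ a ≡ a
      ba-min = m≥n⇒m⊓n≡n (<⇒≤ a<b)
      ba-max : b ⊔ a ≡ b
      ba-max = m≥n⇒m⊔n≡m (<⇒≤ a<b)
      quad : ∀ {P Q} → P ≡ a' → Q ≡ b' → Quad n T' P Q b a
      quad refl refl =
        a'<b , b<b' , inj₂ (1≤a , a<a') , keptEdge a'b a'b≢ab ,
        keptEdge (subst₂ (Edge n T) (m≤n⇒m⊓n≡m (<⇒≤ b<b')) (m≤n⇒m⊔n≡n (<⇒≤ b<b')) bb')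
                 (λ { (b≡a , _) → <-irrefl (sym b≡a) a<b }) ,
        subst₂ (Edge n T') (⊓-comm a b') (⊔-comm a b') (keptEdge ab' ab'≢ab) ,
        subst₂ (Edge n T') (sym (m≥n⇒m⊓n≡n (<⇒≤ a<a'))) (sym (m≥n⇒m⊔n≡m (<⇒≤ a<a'))) (keptEdge aa' aa'≢ab)
  ... | inj₂ (p≡b' , q≡a' , _ , b'<a) =
    a , b , (quad p≡b' q≡a' , unflip-≐ ab-min ab-max) , ab-min , ab-max
    where
      ab-min : a ⊓ b ≡ a
      ab-min = m≤n⇒m⊓n≡m (<⇒≤ a<b)
      ab-max : a ⊔ b ≡ b
      ab-max = m≤n⇒m⊔n≡n (<⇒≤ a<b)
      quad : ∀ {P Q} → P ≡ b' → Q ≡ a' → Quad n T' P Q a b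
      quad refl refl =
        b'<a , a<a' , inj₁ (a'<b , b≤n) ,
        keptEdge (subst₂ (Edge n T) (m≥n⇒m⊓n≡n (<⇒≤ b'<a)) (m≥n⇒m⊔n≡m (<⇒≤ b'<a)) ab')
                 (λ { (b'≡a , _) → <-irrefl b'≡a b'<a }) ,
        keptEdge aa' aa'≢ab ,
        subst₂ (Edge n T') (sym (m≤n⇒m⊓n≡m (<⇒≤ a'<b))) (sym (m≤n⇒m⊔n≡n (<⇒≤ a'<b))) (keptEdge a'b a'b≢ab) ,
        subst₂ (Edge n T') (⊓-comm b b') (⊔-comm b b') (keptEdge bb' bb'≢ab)

FlipAtSide-inverse : ∀ {n Ti Tj Ti' Tj'}
  → IsTriangulation n Ti → IsTriangulation n Tj → Disjoint Ti Tj
  → FlipAtSide n Ti Tj Ti' Tj'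
  → IsTriangulation n Ti' × IsTriangulation n Tj' × Disjoint Ti' Tj'
    × (FlipAtSide n Tj' Ti' Tj Ti ⊎ FlipAtSide n Ti' Tj' Ti Tj)
FlipAtSide-inverse {n} {Ti} {Tj} {Ti'} {Tj'} triᵢ triⱼ disjoint
  (a , b , ab∈Ti , a' , b' , ((a<a' , a'<b , b'-pos , aa' , a'b , bb' , ab') , Ti'≐) ,
   inj₁ (pq∈Tj , (c' , d' , ((p<c' , c'<q , d'-pos , pc' , c'q , qd' , pd') , Tj'≐)))) =
  I.isTriangulation , J.isTriangulation , disjoint' , inj₁ inverse
  where
    module I = Flip triᵢ ab∈Ti a<a' a'<b b'-pos aa' a'b bb' ab' Ti'≐
    module J = Flip triⱼ pq∈Tj p<c' c'<q d'-pos pc' c'q qd' pd' Tj'≐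
    disjoint' : Disjoint Ti' Tj'
    disjoint' x y xy∈Ti' xy∈Tj' with J.T'-cases xy∈Tj'
    ... | inj₂ (refl , refl) = I.noncrossingT' _ _ _ _ I.pq∈T' xy∈Ti' J.ab-crosses-pq
    ... | inj₁ (xy∈Tj , ≢pq) with I.T'-cases xy∈Ti'
    ...   | inj₁ (xy∈Ti , _) = disjoint x y xy∈Ti xy∈Tj
    ...   | inj₂ ≡pq         = ≢pq ≡pq
    inverse : FlipAtSide n Tj' Ti' Tj Ti
    inverse with J.unflip | I.unflip
    ... | (a'' , b'' , unflipⱼ , min≡p , max≡q) | (a''' , b''' , unflipᵢ , _) =
      J.p , J.q , J.pq∈T' , a'' , b'' , unflipⱼ ,
      inj₁ (subst₂ Ti' (sym min≡p) (sym max≡q) I.pq∈T' ,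
            subst₂ (λ u v → FlipsTo n Ti' u v Ti) (sym min≡p) (sym max≡q) (a''' , b''' , unflipᵢ))
FlipAtSide-inverse {n} {Ti} {Tj} {Ti'} {Tj'} triᵢ triⱼ disjoint
  (a , b , ab∈Ti , a' , b' , ((a<a' , a'<b , b'-pos , aa' , a'b , bb' , ab') , Ti'≐) ,
   inj₂ (pq∉Tj , Tj'≐Tj)) =
  I.isTriangulation , IsTriangulation-resp-≐ Tj'≐Tj triⱼ , disjoint' , inj₂ inverse
  where
    module I = Flip triᵢ ab∈Ti a<a' a'<b b'-pos aa' a'b bb' ab' Ti'≐
    disjoint' : Disjoint Ti' Tj'
    disjoint' x y xy∈Ti' xy∈Tj' with I.T'-cases xy∈Ti'
    ... | inj₁ (xy∈Ti , _)   = disjoint x y xy∈Ti (proj₁ (Tj'≐Tj x y) xy∈Tj')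
    ... | inj₂ (refl , refl) = pq∉Tj (proj₁ (Tj'≐Tj x y) xy∈Tj')
    inverse : FlipAtSide n Ti' Tj' Ti Tj
    inverse with I.unflip
    ... | (a'' , b'' , unflipᵢ , refl , refl) =
      I.p , I.q , I.pq∈T' , a'' , b'' , unflipᵢ ,
      inj₂ ((λ ab∈Tj' → disjoint a b ab∈Ti (proj₁ (Tj'≐Tj a b) ab∈Tj')) , ≐-sym Tj'≐Tj)

lemma4p2 : (n : ℕ) (T₁ T₂ T₁' T₂' : DSet)
    → IsTriangulation n T₁ → IsTriangulation n T₂ → Disjoint T₁ T₂
    → PairFlip n T₁ T₂ T₁' T₂'
    → IsTriangulation n T₁' × IsTriangulation n T₂' × Disjoint T₁' T₂'
    × PairFlip n T₁' T₂' T₁ T₂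
lemma4p2 n T₁ T₂ T₁' T₂' tri₁ tri₂ disjoint (inj₁ flip₁)
  with FlipAtSide-inverse tri₁ tri₂ disjoint flip₁
... | tri₁' , tri₂' , disjoint' , inj₁ inverse₂ = tri₁' , tri₂' , disjoint' , inj₂ inverse₂
... | tri₁' , tri₂' , disjoint' , inj₂ inverse₁ = tri₁' , tri₂' , disjoint' , inj₁ inverse₁
lemma4p2 n T₁ T₂ T₁' T₂' tri₁ tri₂ disjoint (inj₂ flip₂)
  with FlipAtSide-inverse tri₂ tri₁ (Disjoint-sym disjoint) flip₂
... | tri₂' , tri₁' , disjoint' , inj₁ inverse₁ = tri₁' , tri₂' , Disjoint-sym disjoint' , inj₁ inverse₁
... | tri₂' , tri₁' , disjoint' , inj₂ inverse₂ = tri₁' , tri₂' , Disjoint-sym disjoint' , inj₂ inverse₂
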